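{- For all positive integers $A,B$, one has $(AB)_\infty\le A_\infty B_1$.
   Context: For a positive integer $A$ with decimal representation $A=\sum_{i=0}^{a} a_i 10^i$ (digits $a_i\in\{0,\dots,9\}$, $a_a\neq0$), let $P(A,x)=\sum_{i=0}^a a_i x^i$, let $A_\infty=\max_i a_i$ be the largest decimal digit of $A$, and let $A_1=P(A,1)=\sum_i a_i$ be the sum of the decimal digits of $A$. Here $(AB)_\infty$ is the largest decimal digit of the product $A\times B$. -}

module Defs where

open import Data.Nat using (ℕ; zero; suc; _+_; _⊔_)
open import Data.Nat.DivMod using (_/_; _%_)
open import Data.List using (List; []; _∷_; foldr)
open import Data.Nat.ListAction using (sum)

-- Decimal digits (least significant first), computed with fuel.
-- With fuel ≥ n (e.g. fuel = n) this gives the full decimal expansion of n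
-- (no leading zeros; the empty list for n = 0).
digitsAux : ℕ → ℕ → List ℕ
digitsAux zero    n = []
digitsAux (suc f) zero = []
digitsAux (suc f) n@(suc _) = (n % 10) ∷ digitsAux f (n / 10)

digits : ℕ → List ℕ
digits n = digitsAux n n

maxDigit : ℕ → ℕ
maxDigit n = foldr _⊔_ 0 (digits n)

digitSum : ℕ → ℕ
digitSum n = sum (digits n)

module Submission where

-- Say that "the digits of n are at most m" when every decimal
-- digit of n, obtained by repeatedly taking n % 10 and n / 10, is ≤ m.  This
-- property is closed under the operations used in schoolbook multiplication,
-- as long as no carries can occur:
--   * adding x and y whose digits are bounded by p and q with p + q ≤ 9
--     gives a number whose digits are bounded by p + q (no carry);
--   * multiplying by 10 (a shift) keeps the bound;
--   * hence multiplying by a decimal digit k with k·p ≤ 9 gives bound k·p.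
-- Writing B = b₀ + 10·B' and A·B = b₀·A + 10·(A·B'), induction on the number
-- of digits of B shows: if A_∞·B_1 ≤ 9 then every digit of A·B is at most
-- A_∞·B_1, so (AB)_∞ ≤ A_∞·B_1.  If A_∞·B_1 > 9 the claim follows because
-- every decimal digit is at most 9.

open import Defs
open import Data.Nat using (ℕ; zero; suc; _+_; _*_; _⊔_; _≤_; _<_; z≤n; s≤s; _≤?_; NonZero)
open import Data.Nat.Properties
open import Data.Nat.DivMod
open import Data.List using (foldr)
open import Data.Nat.ListAction using (sum)
open import Relation.Binary.PropositionalEquality
open import Relation.Nullary using (yes; no)
open import Data.Nat.Solver using (module +-*-Solver)
open +-*-Solver using (solve; _:=_; _:+_; _:*_; con)

data DigitsAtMost (m : ℕ) : ℕ → Set where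
  digits-of-zero : DigitsAtMost m 0
  digits-step    : ∀ {n} → n % 10 ≤ m → DigitsAtMost m (n / 10) → DigitsAtMost m n

digitsAtMost-weaken : ∀ {m m' n} → m ≤ m' → DigitsAtMost m n → DigitsAtMost m' n
digitsAtMost-weaken m≤m' digits-of-zero     = digits-of-zero
digitsAtMost-weaken m≤m' (digits-step d ds) =
  digits-step (≤-trans d m≤m') (digitsAtMost-weaken m≤m' ds)

fuel-/10 : ∀ n f → suc n ≤ suc f → suc n / 10 ≤ f
fuel-/10 n f n<f = ≤-pred (≤-trans (m/n<m (suc n) 10 (s≤s (s≤s z≤n))) n<f)

-- The largest computed digit is at most any bound on all digits
-- (for any fuel: truncating the expansion only removes digits).
maxDigits-≤ : ∀ {m} f n → DigitsAtMost m n → foldr _⊔_ 0 (digitsAux f n) ≤ m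
maxDigits-≤ zero    n       _                  = z≤n
maxDigits-≤ (suc f) zero    _                  = z≤n
maxDigits-≤ (suc f) (suc n) (digits-step d ds) = ⊔-lub d (maxDigits-≤ f (suc n / 10) ds)

digitsAtMost-maxDigits : ∀ f n → n ≤ f → DigitsAtMost (foldr _⊔_ 0 (digitsAux f n)) n
digitsAtMost-maxDigits zero    zero    z≤n = digits-of-zero
digitsAtMost-maxDigits (suc f) zero    _   = digits-of-zero
digitsAtMost-maxDigits (suc f) (suc n) n≤f =
  digits-step (m≤m⊔n _ _)
    (digitsAtMost-weaken (m≤n⊔m (suc n % 10) _)
      (digitsAtMost-maxDigits f (suc n / 10) (fuel-/10 n f n≤f)))

maxDigits-≤9 : ∀ f n → foldr _⊔_ 0 (digitsAux f n) ≤ 9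
maxDigits-≤9 zero    n       = z≤n
maxDigits-≤9 (suc f) zero    = z≤n
maxDigits-≤9 (suc f) (suc n) = ⊔-lub (≤-pred (m%n<n (suc n) 10)) (maxDigits-≤9 f (suc n / 10))

digitsAtMost-+ : ∀ {p q x y} → p + q ≤ 9 →
                 DigitsAtMost p x → DigitsAtMost q y → DigitsAtMost (p + q) (x + y)
digitsAtMost-+ {p} {q} p+q≤9 digits-of-zero dy = digitsAtMost-weaken (m≤n+m q p) dy
digitsAtMost-+ {p} {q} {x} p+q≤9 dx@(digits-step _ _) digits-of-zero =
  subst (DigitsAtMost (p + q)) (sym (+-identityʳ x)) (digitsAtMost-weaken (m≤m+n p q) dx)
digitsAtMost-+ {p} {q} {x} {y} p+q≤9 (digits-step dx dxs) (digits-step dy dys) =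
  digits-step last-digit
    (subst (DigitsAtMost (p + q)) (sym (+-distrib-/ x y no-carry)) (digitsAtMost-+ p+q≤9 dxs dys))
  where
  no-carry : x % 10 + y % 10 < 10
  no-carry = s≤s (≤-trans (+-mono-≤ dx dy) p+q≤9)
  last-digit : (x + y) % 10 ≤ p + q
  last-digit = subst (_≤ p + q) (sym (trans (%-distribˡ-+ x y 10) (m<n⇒m%n≡m no-carry)))
                     (+-mono-≤ dx dy)

digitsAtMost-*10 : ∀ {m y} → DigitsAtMost m y → DigitsAtMost m (y * 10)
digitsAtMost-*10 {m} {y} dy =
  digits-step (subst (_≤ m) (sym (m*n%n≡0 y 10)) z≤n)
              (subst (DigitsAtMost m) (sym (m*n/n≡m y 10)) dy)

digitsAtMost-scale : ∀ {p x} k → k * p ≤ 9 → DigitsAtMost p x → DigitsAtMost (k * p) (k * x)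
digitsAtMost-scale zero    _     _  = digits-of-zero
digitsAtMost-scale {p} (suc k) kp≤9 dx =
  digitsAtMost-+ kp≤9 dx (digitsAtMost-scale k (m+n≤o⇒n≤o p kp≤9) dx)

product-split : ∀ A b₀ B' → A * (b₀ + B' * 10) ≡ b₀ * A + A * B' * 10
product-split = solve 3 (λ A b₀ B' → A :* (b₀ :+ B' :* con 10) := b₀ :* A :+ A :* B' :* con 10) refl

bound-split : ∀ M b₀ s → M * (b₀ + s) ≡ b₀ * M + M * s
bound-split = solve 3 (λ M b₀ s → M :* (b₀ :+ s) := b₀ :* M :+ M :* s) refl

digitsAtMost-product : ∀ f B A M → B ≤ f → DigitsAtMost M A →
                       M * sum (digitsAux f B) ≤ 9 →
                       DigitsAtMost (M * sum (digitsAux f B)) (A * B)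
digitsAtMost-product f zero A M _ _ _ rewrite *-zeroʳ A = digits-of-zero
digitsAtMost-product (suc f) B@(suc n) A M B≤f dA small =
  subst (DigitsAtMost (M * (b₀ + s))) A*B≡
    (subst (λ bound → DigitsAtMost bound (b₀ * A + A * B' * 10)) (sym (bound-split M b₀ s))
      (digitsAtMost-+ small′ (digitsAtMost-scale b₀ (m+n≤o⇒m≤o _ small′) dA)
        (digitsAtMost-*10
          (digitsAtMost-product f B' A M (fuel-/10 n f B≤f) dA (m+n≤o⇒n≤o _ small′)))))
  where
  b₀ = B % 10
  B' = B / 10
  s  = sum (digitsAux f B')
  small′ : b₀ * M + M * s ≤ 9
  small′ = subst (_≤ 9) (bound-split M b₀ s) small
  A*B≡ : b₀ * A + A * B' * 10 ≡ A * B
  A*B≡ = begin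
    b₀ * A + A * B' * 10 ≡⟨ product-split A b₀ B' ⟨
    A * (b₀ + B' * 10)   ≡⟨ cong (A *_) (m≡m%n+[m/n]*n B 10) ⟨
    A * B                ∎
    where open ≡-Reasoning

proposition6 : (A B : ℕ) → .{{_ : NonZero A}} → .{{_ : NonZero B}} →
    maxDigit (A * B) ≤ maxDigit A * digitSum B
proposition6 A B with maxDigit A * digitSum B ≤? 9
... | yes no-carries =
  maxDigits-≤ (A * B) (A * B)
    (digitsAtMost-product B B A (maxDigit A) ≤-refl (digitsAtMost-maxDigits A A ≤-refl) no-carries)
... | no carries = ≤-trans (maxDigits-≤9 (A * B) (A * B)) (<⇒≤ (≰⇒> carries))
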